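{- Let $m\in\mathbb{N}$ and let $\Gamma^f=(\langle L,R,E\rangle,\{1,\dots,m\},f)$ be a countable $\{1,\dots,m\}$-labelled bipartite graph such that $L$ or $R$ is finite. Then $\Gamma^f$ is $\aleph_0$-categorical.
   Context: A countable structure is $\aleph_0$-categorical iff its automorphism group has finitely many orbits on $n$-tuples for each $n\ge1$. A bipartite graph $\langle L,R,E\rangle$ has disjoint non-empty vertex sets $L,R$ and edges $E\subseteq\{\{x,y\}:x\in L,y\in R\}$. A $\Sigma$-labelled bipartite graph $(\Gamma,\Sigma,f)$ consists of a bipartite graph $\Gamma=\langle L,R,E\rangle$ and a surjection $f:E\to\Sigma$; it is viewed as a structure with unary relations for $L$ and $R$, a binary edge relation, and for each $\sigma\in\Sigma$ a binary relation $E_\sigma$ with $(x,y)\in E_\sigma$ iff $\{x,y\}\in E$ and $\{x,y\}f=\sigma$. Its automorphisms are the bijections preserving $L$, $R$, edges and non-edges, and labels. -}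

module Defs where

open import Data.Nat using (ℕ; _≤_)
open import Data.Fin using (Fin)
open import Data.Maybe using (Maybe; just; nothing)
open import Data.Sum using (_⊎_; inj₁; inj₂)
open import Data.Product using (Σ; ∃; ∃-syntax; _×_; _,_)
open import Data.Bool using (Bool; true; false)
open import Function.Bundles using (_↔_; _↣_; Inverse)
open import Relation.Binary.PropositionalEquality using (_≡_)

-- The edge set together with the labelling f : E → Σ is encoded as a
-- function  lab : L → R → Maybe (Fin m)  :
--   lab l r ≡ nothing   iff {l,r} ∉ E,
--   lab l r ≡ just σ    iff {l,r} ∈ E and {l,r}f = σ.
record LabelledBipartiteGraph (m : ℕ) : Set₁ where
  field
    L R      : Set
    lab      : L → R → Maybe (Fin m)
    L-nonempty : L
    R-nonempty : R
    f-surjective : (σ : Fin m) → ∃[ l ] ∃[ r ] (lab l r ≡ just σ)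

  V : Set
  V = L ⊎ R

  isL : V → Bool
  isL (inj₁ _) = true
  isL (inj₂ _) = false

  edgeLabel : V → V → Maybe (Fin m)
  edgeLabel (inj₁ l) (inj₂ r) = lab l r
  edgeLabel (inj₂ r) (inj₁ l) = lab l r
  edgeLabel (inj₁ _) (inj₁ _) = nothing
  edgeLabel (inj₂ _) (inj₂ _) = nothing

open LabelledBipartiteGraph public

record Automorphism {m : ℕ} (Γ : LabelledBipartiteGraph m) : Set where
  field
    perm          : V Γ ↔ V Γ
    preserves-L   : ∀ v → isL Γ (Inverse.to perm v) ≡ isL Γ v
    preserves-lab : ∀ x y →
      edgeLabel Γ (Inverse.to perm x) (Inverse.to perm y) ≡ edgeLabel Γ x y

Countable : Set → Set
Countable A = A ↣ ℕ

Finite : Set → Set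
Finite A = ∃[ k ] (A ↔ Fin k)

Tuple : {m : ℕ} → LabelledBipartiteGraph m → ℕ → Set
Tuple Γ n = Fin n → V Γ

SameOrbit : {m : ℕ} (Γ : LabelledBipartiteGraph m) {n : ℕ} →
            Tuple Γ n → Tuple Γ n → Set
SameOrbit Γ t s = ∃[ g ] (∀ i → Inverse.to (Automorphism.perm {Γ = Γ} g) (t i) ≡ s i)

-- Aut(Γ) has finitely many orbits on n-tuples: there is a map from
-- n-tuples to a finite set Fin k whose fibres lie inside orbits
-- (so there are at most k orbits).
FinitelyManyOrbits : {m : ℕ} (Γ : LabelledBipartiteGraph m) (n : ℕ) → Set
FinitelyManyOrbits Γ n =
  ∃[ k ] Σ (Tuple Γ n → Fin k) λ c →
    ∀ t s → c t ≡ c s → SameOrbit Γ t s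

-- ℵ₀-categorical (via Ryll-Nardzewski characterisation given in context)
Aleph0Categorical : {m : ℕ} → LabelledBipartiteGraph m → Set
Aleph0Categorical Γ = ∀ n → 1 ≤ n → FinitelyManyOrbits Γ n

module Submission where

-- Call two vertices of Γ twins if they lie on the same side and
-- carry the same label (or non-edge) towards every vertex.  Any permutation of
-- the vertices that only moves vertices inside their twin class is an
-- automorphism.  Suppose the twin relation is refined by a classification of
-- the vertices into finitely many classes Fin K.  Two n-tuples with the same
-- sequence of classes and the same equality pattern (which entries coincide)
-- are then mapped onto each other by a class-preserving permutation, built
-- from transpositions one entry at a time; as there are only finitely many
-- such data, Aut(Γ) has finitely many orbits on n-tuples.  If L is finite,
-- each vertex of L is its own class and a vertex of R is classified by its
-- (finite) column of labels from L; finite R reduces to this by exchanging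
-- the two sides.  Countability is used only to decide equality of vertices,
-- which the transpositions need.

open import Defs
open import Data.Nat using (ℕ; zero; suc; _^_; _*_; _+_)
open import Data.Nat.Properties using () renaming (_≟_ to _≟ℕ_)
open import Data.Fin using (Fin; zero; suc; combine; join; splitAt; funToFin; finToFun)
open import Data.Fin.Properties using (combine-injective; splitAt-join; finToFun-funToFin)
open import Data.Maybe using (Maybe; just; nothing)
open import Data.Bool using (not)
open import Data.Bool.Properties using (not-injective)
open import Data.Sum using (_⊎_; inj₁; inj₂; swap)
open import Data.Sum.Properties using (inj₁-injective; inj₂-injective)
open import Data.Product using (Σ; _×_; _,_; proj₁; proj₂)
open import Data.Empty using (⊥-elim)
open import Function using (_∘_)
open import Function.Bundles using (_↔_; Inverse; Injection; mk↔ₛ′)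
open import Function.Properties.Inverse using (↔-refl; ↔-trans; ↔⇒↣)
open import Relation.Nullary using (Dec; yes; no; ¬_)
open import Relation.Nullary.Decidable using (via-injection)
open import Relation.Binary.Definitions using (DecidableEquality)
open import Relation.Binary.PropositionalEquality

open Inverse using (to; from)

funToFin-injective : ∀ {a b} (f g : Fin a → Fin b) →
                     funToFin f ≡ funToFin g → ∀ i → f i ≡ g i
funToFin-injective f g eq i = begin
  f i                     ≡⟨ finToFun-funToFin f i ⟨
  finToFun (funToFin f) i ≡⟨ cong (λ k → finToFun k i) eq ⟩
  finToFun (funToFin g) i ≡⟨ finToFun-funToFin g i ⟩
  g i                     ∎
  where open ≡-Reasoning

join-injective : ∀ a b (u v : Fin a ⊎ Fin b) → join a b u ≡ join a b v → u ≡ v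
join-injective a b u v eq = begin
  u                      ≡⟨ splitAt-join a b u ⟨
  splitAt a (join a b u) ≡⟨ cong (splitAt a) eq ⟩
  splitAt a (join a b v) ≡⟨ splitAt-join a b v ⟩
  v                      ∎
  where open ≡-Reasoning

maybeToFin : ∀ {m} → Maybe (Fin m) → Fin (suc m)
maybeToFin nothing  = zero
maybeToFin (just σ) = suc σ

maybeToFin-injective : ∀ {m} {x y : Maybe (Fin m)} → maybeToFin x ≡ maybeToFin y → x ≡ y
maybeToFin-injective {x = nothing} {nothing} _    = refl
maybeToFin-injective {x = just _}  {just _}  refl = refl

decBit : {P : Set} → Dec P → Fin 2
decBit (yes _) = zero
decBit (no _)  = suc zero

decBit-transfer : {P Q : Set} (p : Dec P) (q : Dec Q) → decBit p ≡ decBit q → P → Q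
decBit-transfer (yes _) (yes q) _  _ = q
decBit-transfer (no ¬p) _       _  p = ⊥-elim (¬p p)

module Permutations {A : Set} (_≟_ : DecidableEquality A) where

  transpose : A → A → A → A
  transpose x y z with z ≟ x
  ... | yes _ = y
  ... | no _ with z ≟ y
  ...   | yes _ = x
  ...   | no _  = z

  transpose-x : ∀ x y → transpose x y x ≡ y
  transpose-x x y with x ≟ x
  ... | yes _   = refl
  ... | no x≢x = ⊥-elim (x≢x refl)

  transpose-y : ∀ x y → transpose x y y ≡ x
  transpose-y x y with y ≟ x
  ... | yes y≡x = y≡x
  ... | no _ with y ≟ y
  ...   | yes _   = refl
  ...   | no y≢y = ⊥-elim (y≢y refl)

  transpose-fix : ∀ x y z → ¬ z ≡ x → ¬ z ≡ y → transpose x y z ≡ z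
  transpose-fix x y z z≢x z≢y with z ≟ x
  ... | yes z≡x = ⊥-elim (z≢x z≡x)
  ... | no _ with z ≟ y
  ...   | yes z≡y = ⊥-elim (z≢y z≡y)
  ...   | no _    = refl

  transpose-involutive : ∀ x y z → transpose x y (transpose x y z) ≡ z
  transpose-involutive x y z with z ≟ x
  ... | yes refl = transpose-y z y
  ... | no z≢x with z ≟ y
  ...   | yes refl = transpose-x x z
  ...   | no z≢y   = transpose-fix x y z z≢x z≢y

  transposition : A → A → A ↔ A
  transposition x y = mk↔ₛ′ (transpose x y) (transpose x y)
                            (transpose-involutive x y) (transpose-involutive x y)

  SamePattern : ∀ {n} → (Fin n → A) → (Fin n → A) → Set
  SamePattern t s = ∀ i j → t i ≡ t j → s i ≡ s j

  module _ {C : Set} (τ : A → C) where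

    ColourPreserving : A ↔ A → Set
    ColourPreserving π = ∀ z → τ (to π z) ≡ τ z

    transpose-colour : ∀ {x y} → τ x ≡ τ y → ∀ z → τ (transpose x y z) ≡ τ z
    transpose-colour {x} {y} τx≡τy z with z ≟ x
    ... | yes refl = sym τx≡τy
    ... | no _ with z ≟ y
    ...   | yes refl = τx≡τy
    ...   | no _     = refl

    -- Induction on the
    -- length: after matching the tail, the head is moved into place by a
    -- transposition, which fixes the tail since the patterns agree.
    similar⇒conjugate : ∀ {n} (t s : Fin n → A) → (∀ i → τ (t i) ≡ τ (s i)) →
      SamePattern t s → SamePattern s t →
      Σ (A ↔ A) λ π → ColourPreserving π × (∀ i → to π (t i) ≡ s i)
    similar⇒conjugate {zero} t s _ _ _ = ↔-refl , (λ _ → refl) , λ ()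
    similar⇒conjugate {suc n} t s colour t→s s→t
      with similar⇒conjugate (t ∘ suc) (s ∘ suc) (colour ∘ suc)
             (λ i j → t→s (suc i) (suc j)) (λ i j → s→t (suc i) (suc j))
    ... | π , π-colour , π-tail with to π (t zero) ≟ s zero
    ...   | yes π-head = π , π-colour , λ { zero → π-head ; (suc i) → π-tail i }
    ...   | no π-miss  = ↔-trans π (transposition x (s zero)) , colour′ , placed
      where
        x = to π (t zero)
        τx≡τs₀ : τ x ≡ τ (s zero)
        τx≡τs₀ = trans (π-colour (t zero)) (colour zero)

        colour′ : ColourPreserving (↔-trans π (transposition x (s zero)))
        colour′ z = trans (transpose-colour τx≡τs₀ (to π z)) (π-colour z)

        tail≢s₀ : ∀ i → ¬ s (suc i) ≡ s zero
        tail≢s₀ i eq = π-miss (begin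
          to π (t zero)    ≡⟨ cong (to π) (s→t (suc i) zero eq) ⟨
          to π (t (suc i)) ≡⟨ π-tail i ⟩
          s (suc i)        ≡⟨ eq ⟩
          s zero           ∎)
          where open ≡-Reasoning

        tail≢x : ∀ i → ¬ s (suc i) ≡ x
        tail≢x i eq = tail≢s₀ i (t→s (suc i) zero
          (Injection.injective (↔⇒↣ π) (trans (π-tail i) eq)))

        placed : ∀ i → transpose x (s zero) (to π (t i)) ≡ s i
        placed zero    = transpose-x x (s zero)
        placed (suc i) = trans (cong (transpose x (s zero)) (π-tail i))
                               (transpose-fix x (s zero) (s (suc i)) (tail≢x i) (tail≢s₀ i))

module _ {m : ℕ} (Γ : LabelledBipartiteGraph m) where

  edgeLabel-sym : ∀ x y → edgeLabel Γ x y ≡ edgeLabel Γ y x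
  edgeLabel-sym (inj₁ _) (inj₁ _) = refl
  edgeLabel-sym (inj₁ _) (inj₂ _) = refl
  edgeLabel-sym (inj₂ _) (inj₁ _) = refl
  edgeLabel-sym (inj₂ _) (inj₂ _) = refl

  Twins : V Γ → V Γ → Set
  Twins x y = (isL Γ x ≡ isL Γ y) × (∀ w → edgeLabel Γ x w ≡ edgeLabel Γ y w)

  same-column⇒twins : ∀ r r′ → (∀ l → lab Γ l r ≡ lab Γ l r′) →
                      Twins (inj₂ r) (inj₂ r′)
  same-column⇒twins r r′ same = refl , λ { (inj₁ l) → same l ; (inj₂ _) → refl }

  record TwinClassification : Set where
    field
      classes     : ℕ
      class       : V Γ → Fin classes
      class-twins : ∀ x y → class x ≡ class y → Twins x y

  module Orbits (_≟_ : DecidableEquality (V Γ)) (T : TwinClassification) where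
    open TwinClassification T
    open Permutations _≟_

    class-preserving⇒automorphism : (π : V Γ ↔ V Γ) → ColourPreserving class π →
                                    Automorphism Γ
    class-preserving⇒automorphism π preserves = record
      { perm          = π
      ; preserves-L   = λ v → proj₁ (twin v)
      ; preserves-lab = λ x y → begin
          edgeLabel Γ (to π x) (to π y) ≡⟨ proj₂ (twin x) (to π y) ⟩
          edgeLabel Γ x (to π y)        ≡⟨ edgeLabel-sym x (to π y) ⟩
          edgeLabel Γ (to π y) x        ≡⟨ proj₂ (twin y) x ⟩
          edgeLabel Γ y x               ≡⟨ edgeLabel-sym y x ⟩
          edgeLabel Γ x y               ∎ }
      where
        open ≡-Reasoning
        twin : ∀ v → Twins (to π v) v
        twin v = class-twins (to π v) v (preserves v)

    -- The complete invariant of an n-tuple: its classes and its equality pattern.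
    equalityBits : ∀ {n} → Tuple Γ n → Fin n → Fin n → Fin 2
    equalityBits t i j = decBit (t i ≟ t j)

    classesCode : ∀ {n} → Tuple Γ n → Fin (classes ^ n)
    classesCode t = funToFin (class ∘ t)

    patternCode : ∀ {n} → Tuple Γ n → Fin ((2 ^ n) ^ n)
    patternCode t = funToFin (funToFin ∘ equalityBits t)

    tupleCode : ∀ {n} → Tuple Γ n → Fin (classes ^ n * (2 ^ n) ^ n)
    tupleCode t = combine (classesCode t) (patternCode t)

    module _ {n} (t s : Tuple Γ n) (eq : tupleCode t ≡ tupleCode s) where
      private
        same-parts = combine-injective (classesCode t) (patternCode t)
                                       (classesCode s) (patternCode s) eq

        same-bit : ∀ i j → equalityBits t i j ≡ equalityBits s i j
        same-bit i j = funToFin-injective (equalityBits t i) (equalityBits s i)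
          (funToFin-injective (funToFin ∘ equalityBits t) (funToFin ∘ equalityBits s)
                              (proj₂ same-parts) i) j

      code-classes : ∀ i → class (t i) ≡ class (s i)
      code-classes = funToFin-injective (class ∘ t) (class ∘ s) (proj₁ same-parts)

      code-pattern : SamePattern t s
      code-pattern i j = decBit-transfer (t i ≟ t j) (s i ≟ s j) (same-bit i j)

      code-pattern′ : SamePattern s t
      code-pattern′ i j = decBit-transfer (s i ≟ s j) (t i ≟ t j) (sym (same-bit i j))

    finitelyManyOrbits : ∀ n → FinitelyManyOrbits Γ n
    finitelyManyOrbits n = _ , tupleCode , same-code⇒same-orbit
      where
        same-code⇒same-orbit : ∀ t s → tupleCode t ≡ tupleCode s → SameOrbit Γ t s
        same-code⇒same-orbit t s eq
          with π , preserves , t↦s ← similar⇒conjugate class t s (code-classes t s eq)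
                                       (code-pattern t s eq) (code-pattern′ t s eq)
          = class-preserving⇒automorphism π preserves , t↦s

finiteL⇒twinClassification : ∀ {m} (Γ : LabelledBipartiteGraph m) →
                              Finite (L Γ) → TwinClassification Γ
finiteL⇒twinClassification {m} Γ (a , ι) = record
  { classes     = a + suc m ^ a
  ; class       = join a _ ∘ position
  ; class-twins = λ x y eq →
      same-position⇒twins x y (join-injective a _ (position x) (position y) eq)
  }
  where
    column : R Γ → Fin (suc m ^ a)
    column r = funToFin λ i → maybeToFin (lab Γ (from ι i) r)

    position : V Γ → Fin a ⊎ Fin (suc m ^ a)
    position (inj₁ l) = inj₁ (to ι l)
    position (inj₂ r) = inj₂ (column r)

    same-labels : ∀ {r r′} → column r ≡ column r′ → ∀ l → lab Γ l r ≡ lab Γ l r′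
    same-labels {r} {r′} eq l = begin
      lab Γ l r                  ≡⟨ cong (λ l → lab Γ l r) (Inverse.strictlyInverseʳ ι l) ⟨
      lab Γ (from ι (to ι l)) r  ≡⟨ maybeToFin-injective (funToFin-injective _ _ eq (to ι l)) ⟩
      lab Γ (from ι (to ι l)) r′ ≡⟨ cong (λ l → lab Γ l r′) (Inverse.strictlyInverseʳ ι l) ⟩
      lab Γ l r′                 ∎
      where open ≡-Reasoning

    same-position⇒twins : ∀ x y → position x ≡ position y → Twins Γ x y
    same-position⇒twins (inj₁ l) (inj₁ l′) eq
      with refl ← Injection.injective (↔⇒↣ ι) (inj₁-injective eq) = refl , λ _ → refl
    same-position⇒twins (inj₂ r) (inj₂ r′) eq =
      same-column⇒twins Γ r r′ (same-labels (inj₂-injective eq))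
    same-position⇒twins (inj₁ _) (inj₂ _) ()
    same-position⇒twins (inj₂ _) (inj₁ _) ()

flipSides : ∀ {m} → LabelledBipartiteGraph m → LabelledBipartiteGraph m
flipSides Γ = record
  { L            = R Γ
  ; R            = L Γ
  ; lab          = λ r l → lab Γ l r
  ; L-nonempty   = R-nonempty Γ
  ; R-nonempty   = L-nonempty Γ
  ; f-surjective = λ σ → let l , r , labelled = f-surjective Γ σ in r , l , labelled
  }

module _ {m : ℕ} (Γ : LabelledBipartiteGraph m) where

  isL-flip : ∀ x → isL (flipSides Γ) (swap x) ≡ not (isL Γ x)
  isL-flip (inj₁ _) = refl
  isL-flip (inj₂ _) = refl

  edgeLabel-flip : ∀ x y → edgeLabel (flipSides Γ) (swap x) (swap y) ≡ edgeLabel Γ x y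
  edgeLabel-flip (inj₁ _) (inj₁ _) = refl
  edgeLabel-flip (inj₁ _) (inj₂ _) = refl
  edgeLabel-flip (inj₂ _) (inj₁ _) = refl
  edgeLabel-flip (inj₂ _) (inj₂ _) = refl

  flip-twins : ∀ x y → Twins (flipSides Γ) (swap x) (swap y) → Twins Γ x y
  flip-twins x y (same-side , same-labels) =
    not-injective (trans (sym (isL-flip x)) (trans same-side (isL-flip y))) ,
    λ w → trans (sym (edgeLabel-flip x w)) (trans (same-labels (swap w)) (edgeLabel-flip y w))

  flip-twinClassification : TwinClassification (flipSides Γ) → TwinClassification Γ
  flip-twinClassification T = record
    { classes     = classes
    ; class       = class ∘ swap
    ; class-twins = λ x y eq → flip-twins x y (class-twins (swap x) (swap y) eq)
    }
    where open TwinClassification T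

  finiteSide⇒twinClassification : Finite (L Γ) ⊎ Finite (R Γ) → TwinClassification Γ
  finiteSide⇒twinClassification (inj₁ finiteL) = finiteL⇒twinClassification Γ finiteL
  finiteSide⇒twinClassification (inj₂ finiteR) =
    flip-twinClassification (finiteL⇒twinClassification (flipSides Γ) finiteR)

lemma5p21 : (m : ℕ) (Γ : LabelledBipartiteGraph m) →
    Countable (V Γ) →
    Finite (L Γ) ⊎ Finite (R Γ) →
    Aleph0Categorical Γ
lemma5p21 m Γ countable finiteSide n _ = Orbits.finitelyManyOrbits Γ
  (via-injection countable _≟ℕ_) (finiteSide⇒twinClassification Γ finiteSide) n
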